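{- Let $\mathcal{C}=\{c_1,\ldots,c_m\}$ be a collection of cliques with graph union $U$. The clique number of $U$ equals \[ \max_{\mathcal{F}\in\mathcal{M}}\ \sum_{J\in\mathcal{F}}\gamma_J, \] where $\mathcal{M}$ is the set of all maximal intersecting families on $\{1,\ldots,m\}$, i.e. intersecting families $\mathcal{F}\subseteq\mathcal{P}(\{1,\ldots,m\})$ not properly contained in any other intersecting family of subsets of $\{1,\ldots,m\}$.
   Context: A clique is identified with its vertex set. The graph union $U$ of $c_1,\ldots,c_m$ has vertex set $V=\bigcup_j c_j$, and distinct $u,v\in V$ are adjacent iff $u,v\in c_j$ for some $j$. For $J\subseteq\{1,\ldots,m\}$, $\Gamma_J$ is the set of $v\in V$ with $\{j:v\in c_j\}=J$, and $\gamma_J=|\Gamma_J|$. A family of sets is intersecting if any two distinct members have nonempty intersection. -}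

module Defs where

open import Data.Nat using (ℕ; zero; suc; _+_; _≤_)
open import Data.Bool using (Bool; true; false; if_then_else_; _∧_)
open import Data.Fin using (Fin)
open import Data.Fin.Subset using (Subset; _∈_; _⊆_; _∩_; ⋃; ∣_∣; Nonempty; inside; outside)
open import Data.Vec using (Vec; []; _∷_; tabulate; lookup)
import Data.Vec.Properties as VP
import Data.Bool.Properties as BP
open import Data.List using (List; [_]; _++_; map)
open import Data.Nat.ListAction using (sum)
import Data.List as L
open import Data.Product using (Σ; _×_; ∃)
open import Relation.Binary.PropositionalEquality using (_≡_; _≢_)
open import Relation.Nullary.Decidable using (⌊_⌋)

Cliques : ℕ → ℕ → Set
Cliques m n = Fin m → Subset n

module _ {m n : ℕ} (c : Cliques m n) where

  V : Subset n
  V = ⋃ (L.tabulate c)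

  Adj : Fin n → Fin n → Set
  Adj u v = u ≢ v × ∃ λ j → u ∈ c j × v ∈ c j

  IsCliqueOfUnion : Subset n → Set
  IsCliqueOfUnion S = S ⊆ V × (∀ {u v} → u ∈ S → v ∈ S → u ≢ v → Adj u v)

  profile : Fin n → Subset m
  profile v = tabulate λ j → lookup (c j) v

  Γ : Subset m → Subset n
  Γ J = tabulate λ v → lookup V v ∧ ⌊ VP.≡-dec BP._≟_ (profile v) J ⌋

  γ : Subset m → ℕ
  γ J = ∣ Γ J ∣

allSubsets : (m : ℕ) → List (Subset m)
allSubsets zero = [ [] ]
allSubsets (suc m) = map (inside ∷_) (allSubsets m) ++ map (outside ∷_) (allSubsets m)

Family : ℕ → Set
Family m = Subset m → Bool

_∈F_ : {m : ℕ} → Subset m → Family m → Set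
J ∈F F = F J ≡ true

Intersecting : {m : ℕ} → Family m → Set
Intersecting F = ∀ A B → A ∈F F → B ∈F F → A ≢ B → Nonempty (A ∩ B)

MaximalIntersecting : {m : ℕ} → Family m → Set
MaximalIntersecting {m} F =
  Intersecting F ×
  (∀ (G : Family m) → Intersecting G → (∀ J → J ∈F F → J ∈F G) → ∀ J → J ∈F G → J ∈F F)

sumOver : {m : ℕ} → Family m → (Subset m → ℕ) → ℕ
sumOver {m} F w = sum (map (λ J → if F J then w J else 0) (allSubsets m))

IsMaximum : (ℕ → Set) → ℕ → Set
IsMaximum P k = P k × (∀ x → P x → x ≤ k)

IsCliqueNumber : {m n : ℕ} → Cliques m n → ℕ → Set
IsCliqueNumber c = IsMaximum λ x → Σ (Subset _) λ S → IsCliqueOfUnion c S × ∣ S ∣ ≡ x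

IsMaxFamilyWeight : {m n : ℕ} → Cliques m n → ℕ → Set
IsMaxFamilyWeight {m} c = IsMaximum λ x → Σ (Family m) λ F → MaximalIntersecting F × sumOver F (γ c) ≡ x

{-# OPTIONS --safe #-}
-- Every vertex v of the union lies in exactly one class Γ_J, namely for J its
-- profile {j : v ∈ cⱼ}, and two distinct vertices are adjacent exactly when
-- their profiles meet (a profile of a vertex of V is nonempty). So for an
-- intersecting family F the union of the classes Γ_J, J ∈ F, is a clique of
-- size Σ_{J∈F} γ_J. Conversely the profiles of a maximum clique S form an
-- intersecting family; extending it greedily to a maximal one F gives
-- S ⊆ ⋃_{J∈F} Γ_J, so the weight of F is at least, hence equal to, ∣S∣.
module Submission where

open import Defs
open import Data.Nat using (ℕ; zero; suc; _+_; _≤_; _≟_; s≤s⁻¹)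
open import Data.Nat.Properties
  using (+-identityʳ; +-0-commutativeMonoid; ≤-antisym; ≤∧≢⇒<)
open import Algebra.Properties.CommutativeMonoid.Sum +-0-commutativeMonoid
  using (sum-syntax; ∑-distrib-+; sum-replicate-zero; sum-cong-≗)
open import Data.Bool using (Bool; true; false; if_then_else_; _∧_; _∨_)
open import Data.Fin using (Fin; zero; suc)
import Data.Fin.Properties as Fin
open import Data.Fin.Subset using (Subset; _∈_; _⊆_; _∩_; ⋃; ∣_∣; Nonempty; inside; outside; ⊥)
open import Data.Fin.Subset.Properties
  using (_∈?_; _⊆?_; nonempty?; anySubset?; p⊆q⇒∣p∣≤∣q∣; ∩-comm; x∈p∩q⁻; x∈p∩q⁺; x∈p∪q⁻; ∣p∣≤n; ∉⊥; ∣⊥∣≡0)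
open import Data.Vec using ([]; _∷_; tabulate; lookup)
open import Data.Vec.Properties using (≡-dec; ∷-injectiveʳ; lookup∘tabulate; []=⇒lookup; lookup⇒[]=)
import Data.Bool.Properties as Bool
open import Data.List using (List; []; _∷_; _++_; map)
import Data.List as List
open import Data.List.Properties using (map-++; map-∘; map-cong)
open import Data.List.Membership.Propositional using () renaming (_∈_ to _∈ₗ_)
open import Data.List.Membership.Propositional.Properties using (∈-map⁺; ∈-++⁺ˡ; ∈-++⁺ʳ)
open import Data.List.Relation.Unary.All as All using (All)
open import Data.List.Relation.Unary.Any using (here; there)
open import Data.Nat.ListAction using (sum)
open import Data.Nat.ListAction.Properties using (sum-++)
open import Data.Product using (∃; _×_; Σ; _,_; proj₁)
open import Data.Sum using (_⊎_; inj₁; inj₂)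
open import Function using (_∘_)
open import Relation.Binary.PropositionalEquality
open import Relation.Nullary using (Dec; yes; no; does; ¬?; contradiction)
open import Relation.Nullary.Decidable using (⌊_⌋; map′; _×-dec_; _→-dec_; dec-true; dec-false; isYes≗does)
open import Relation.Unary using (Decidable)

open ≡-Reasoning

𝟙 : Bool → ℕ
𝟙 true = 1
𝟙 false = 0

∧≡true⁻ : ∀ {x y} → x ∧ y ≡ true → x ≡ true × y ≡ true
∧≡true⁻ {true} {true} refl = refl , refl

∣tabulate∣≡∑𝟙 : ∀ {n} (f : Fin n → Bool) → ∣ tabulate f ∣ ≡ ∑[ i < n ] 𝟙 (f i)
∣tabulate∣≡∑𝟙 {zero} f = refl
∣tabulate∣≡∑𝟙 {suc n} f with f zero
... | true = cong suc (∣tabulate∣≡∑𝟙 (f ∘ suc))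
... | false = ∣tabulate∣≡∑𝟙 (f ∘ suc)

∈-tabulate⁻ : ∀ {n} {f : Fin n → Bool} {i} → i ∈ tabulate f → f i ≡ true
∈-tabulate⁻ {f = f} {i} i∈ = trans (sym (lookup∘tabulate f i)) ([]=⇒lookup i∈)

∈-tabulate⁺ : ∀ {n} {f : Fin n → Bool} {i} → f i ≡ true → i ∈ tabulate f
∈-tabulate⁺ {f = f} {i} fi = lookup⇒[]= i (tabulate f) (trans (lookup∘tabulate f i) fi)

∈⋃-tabulate⁻ : ∀ {k n} (d : Fin k → Subset n) {v} → v ∈ ⋃ (List.tabulate d) → ∃ λ j → v ∈ d j
∈⋃-tabulate⁻ {zero} d v∈ = contradiction v∈ ∉⊥
∈⋃-tabulate⁻ {suc k} d v∈ with x∈p∪q⁻ (d zero) (⋃ (List.tabulate (d ∘ suc))) v∈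
... | inj₁ v∈d₀ = zero , v∈d₀
... | inj₂ v∈rest with ∈⋃-tabulate⁻ (d ∘ suc) v∈rest
...   | j , v∈dⱼ = suc j , v∈dⱼ

sum-map-≡0 : ∀ {A : Set} (f : A → ℕ) (xs : List A) → (∀ x → f x ≡ 0) → sum (map f xs) ≡ 0
sum-map-≡0 f [] f≡0 = refl
sum-map-≡0 f (x ∷ xs) f≡0 rewrite f≡0 x = sum-map-≡0 f xs f≡0

sum-map-∑ : ∀ {A : Set} {n} (f : A → Fin n → ℕ) (xs : List A) →
  sum (map (λ x → ∑[ i < n ] f x i) xs) ≡ ∑[ i < n ] sum (map (λ x → f x i) xs)
sum-map-∑ {n = n} f [] = sym (sum-replicate-zero n)
sum-map-∑ f (x ∷ xs) = trans (cong (_ +_) (sum-map-∑ f xs)) (sym (∑-distrib-+ (f x) _))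

∈-allSubsets : ∀ m (J : Subset m) → J ∈ₗ allSubsets m
∈-allSubsets zero [] = here refl
∈-allSubsets (suc m) (inside ∷ J) = ∈-++⁺ˡ (∈-map⁺ (inside ∷_) (∈-allSubsets m J))
∈-allSubsets (suc m) (outside ∷ J) =
  ∈-++⁺ʳ (map (inside ∷_) (allSubsets m)) (∈-map⁺ (outside ∷_) (∈-allSubsets m J))

sum-allSubsets-suc : ∀ m (f : Subset (suc m) → ℕ) →
  sum (map f (allSubsets (suc m)))
    ≡ sum (map (f ∘ (inside ∷_)) (allSubsets m)) + sum (map (f ∘ (outside ∷_)) (allSubsets m))
sum-allSubsets-suc m f = begin
  sum (map f (I ++ O))            ≡⟨ cong sum (map-++ f I O) ⟩
  sum (map f I ++ map f O)        ≡⟨ sum-++ (map f I) (map f O) ⟩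
  sum (map f I) + sum (map f O)   ≡⟨ cong₂ _+_ (cong sum (sym (map-∘ (allSubsets m))))
                                                (cong sum (sym (map-∘ (allSubsets m)))) ⟩
  sum (map (f ∘ (inside ∷_)) (allSubsets m)) + sum (map (f ∘ (outside ∷_)) (allSubsets m)) ∎
  where
  I = map (inside ∷_) (allSubsets m)
  O = map (outside ∷_) (allSubsets m)

sum-allSubsets-δ : ∀ m (p : Subset m) (f : Subset m → ℕ) →
  (∀ J → J ≢ p → f J ≡ 0) → sum (map f (allSubsets m)) ≡ f p
sum-allSubsets-δ zero [] f _ = +-identityʳ (f [])
sum-allSubsets-δ (suc m) (inside ∷ p) f vanish = begin
  sum (map f (allSubsets (suc m)))                                  ≡⟨ sum-allSubsets-suc m f ⟩
  sum (map (f ∘ (inside ∷_)) (allSubsets m)) + _                    ≡⟨ cong₂ _+_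
      (sum-allSubsets-δ m p (f ∘ (inside ∷_)) (λ J J≢p → vanish _ (J≢p ∘ ∷-injectiveʳ)))
      (sum-map-≡0 _ (allSubsets m) (λ J → vanish _ λ ())) ⟩
  f (inside ∷ p) + 0                                                ≡⟨ +-identityʳ _ ⟩
  f (inside ∷ p)                                                    ∎
sum-allSubsets-δ (suc m) (outside ∷ p) f vanish = trans (sum-allSubsets-suc m f) (cong₂ _+_
  (sum-map-≡0 _ (allSubsets m) (λ J → vanish _ λ ()))
  (sum-allSubsets-δ m p (f ∘ (outside ∷_)) (λ J J≢p → vanish _ (J≢p ∘ ∷-injectiveʳ))))

_≟ₛ_ : ∀ {m} (p q : Subset m) → Dec (p ≡ q)
_≟ₛ_ = ≡-dec Bool._≟_

_≡ᵇ_ : ∀ {m} → Subset m → Subset m → Bool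
p ≡ᵇ q = ⌊ p ≟ₛ q ⌋

≡ᵇ-refl : ∀ {m} (p : Subset m) → p ≡ᵇ p ≡ true
≡ᵇ-refl p = trans (isYes≗does (p ≟ₛ p)) (dec-true (p ≟ₛ p) refl)

≢⇒≡ᵇ-false : ∀ {m} {p q : Subset m} → p ≢ q → p ≡ᵇ q ≡ false
≢⇒≡ᵇ-false {p = p} {q} p≢q = trans (isYes≗does (p ≟ₛ q)) (dec-false (p ≟ₛ q) p≢q)

module _ {m n : ℕ} (c : Cliques m n) where

  ⋃Γ : Family m → Subset n
  ⋃Γ F = tabulate λ v → lookup (V c) v ∧ F (profile c v)

  ∈⋃Γ⁻ : ∀ {F v} → v ∈ ⋃Γ F → v ∈ V c × profile c v ∈F F
  ∈⋃Γ⁻ v∈ with ∧≡true⁻ (∈-tabulate⁻ v∈)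
  ... | v∈V , Fv = lookup⇒[]= _ (V c) v∈V , Fv

  ∈⋃Γ⁺ : ∀ {F v} → v ∈ V c → profile c v ∈F F → v ∈ ⋃Γ F
  ∈⋃Γ⁺ v∈V Fv = ∈-tabulate⁺ (cong₂ _∧_ ([]=⇒lookup v∈V) Fv)

  ∈-profile⁻ : ∀ {v j} → j ∈ profile c v → v ∈ c j
  ∈-profile⁻ {v} {j} j∈ = lookup⇒[]= v (c j) (∈-tabulate⁻ j∈)

  ∈-profile⁺ : ∀ {v j} → v ∈ c j → j ∈ profile c v
  ∈-profile⁺ v∈ = ∈-tabulate⁺ ([]=⇒lookup v∈)

  sumOver-γ≡∣⋃Γ∣ : ∀ F → sumOver F (γ c) ≡ ∣ ⋃Γ F ∣
  sumOver-γ≡∣⋃Γ∣ F = begin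
    sum (map (λ J → if F J then γ c J else 0) (allSubsets m))
      ≡⟨ cong sum (map-cong (λ J → γ-as-∑ (F J) J) (allSubsets m)) ⟩
    sum (map (λ J → ∑[ v < n ] term J v) (allSubsets m))
      ≡⟨ sum-map-∑ term (allSubsets m) ⟩
    ∑[ v < n ] sum (map (λ J → term J v) (allSubsets m))
      ≡⟨ sum-cong-≗ (λ v → sum-allSubsets-δ m (profile c v) (λ J → term J v) (off-profile v)) ⟩
    ∑[ v < n ] term (profile c v) v
      ≡⟨ sum-cong-≗ (λ v → on-profile (lookup (V c) v) (F (profile c v)) (≡ᵇ-refl (profile c v))) ⟩
    ∑[ v < n ] 𝟙 (lookup (V c) v ∧ F (profile c v))
      ≡⟨ sym (∣tabulate∣≡∑𝟙 (λ v → lookup (V c) v ∧ F (profile c v))) ⟩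
    ∣ ⋃Γ F ∣ ∎
    where
    term : Subset m → Fin n → ℕ
    term J v = if F J then 𝟙 (lookup (V c) v ∧ profile c v ≡ᵇ J) else 0

    γ-as-∑ : ∀ b J → (if b then γ c J else 0)
                     ≡ ∑[ v < n ] (if b then 𝟙 (lookup (V c) v ∧ profile c v ≡ᵇ J) else 0)
    γ-as-∑ true J = ∣tabulate∣≡∑𝟙 (λ v → lookup (V c) v ∧ profile c v ≡ᵇ J)
    γ-as-∑ false J = sym (sum-replicate-zero n)

    off-profile : ∀ v J → J ≢ profile c v → term J v ≡ 0
    off-profile v J J≢p
      rewrite ≢⇒≡ᵇ-false (J≢p ∘ sym) | Bool.∧-zeroʳ (lookup (V c) v) with F J
    ... | true = refl
    ... | false = refl

    on-profile : ∀ x b {e} → e ≡ true → (if b then 𝟙 (x ∧ e) else 0) ≡ 𝟙 (x ∧ b)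
    on-profile x true refl = refl
    on-profile x false refl = cong 𝟙 (sym (Bool.∧-zeroʳ x))

  adjacent-if-profiles-meet : ∀ {u v} → u ≢ v → Nonempty (profile c u ∩ profile c v) → Adj c u v
  adjacent-if-profiles-meet u≢v (j , j∈) with x∈p∩q⁻ _ _ j∈
  ... | j∈pu , j∈pv = u≢v , j , ∈-profile⁻ j∈pu , ∈-profile⁻ j∈pv

  adjacent-if-same-profile : ∀ {u v} → u ∈ V c → u ≢ v → profile c u ≡ profile c v → Adj c u v
  adjacent-if-same-profile u∈V u≢v same with ∈⋃-tabulate⁻ c u∈V
  ... | j , u∈cⱼ = u≢v , j , u∈cⱼ , ∈-profile⁻ (subst (j ∈_) same (∈-profile⁺ u∈cⱼ))

  ⋃Γ-isClique : ∀ {F} → Intersecting F → IsCliqueOfUnion c (⋃Γ F)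
  ⋃Γ-isClique {F} F-int = (λ v∈ → proj₁ (∈⋃Γ⁻ {F} v∈)) , adjacent
    where
    adjacent : ∀ {u v} → u ∈ ⋃Γ F → v ∈ ⋃Γ F → u ≢ v → Adj c u v
    adjacent {u} {v} u∈ v∈ u≢v with ∈⋃Γ⁻ {F} u∈ | ∈⋃Γ⁻ {F} v∈ | profile c u ≟ₛ profile c v
    ... | u∈V , _ | _ | yes same = adjacent-if-same-profile u∈V u≢v same
    ... | _ , Fu | _ , Fv | no differ = adjacent-if-profiles-meet u≢v (F-int _ _ Fu Fv differ)

  profiles : Subset n → Family m
  profiles S J = does (Fin.any? λ v → (v ∈? S) ×-dec (profile c v ≟ₛ J))

  profile∈profiles : ∀ {S v} → v ∈ S → profile c v ∈F profiles S
  profile∈profiles {v = v} v∈S = dec-true (Fin.any? _) (v , v∈S , refl)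

  ∈profiles⁻ : ∀ {S J} → J ∈F profiles S → ∃ λ v → v ∈ S × profile c v ≡ J
  ∈profiles⁻ {S} {J} J∈ with Fin.any? (λ v → (v ∈? S) ×-dec (profile c v ≟ₛ J))
  ... | yes witness = witness

  profiles-intersecting : ∀ {S} → IsCliqueOfUnion c S → Intersecting (profiles S)
  profiles-intersecting (_ , adj) A B A∈ B∈ A≢B with ∈profiles⁻ A∈ | ∈profiles⁻ B∈
  ... | u , u∈S , refl | v , v∈S , refl with adj u∈S v∈S (A≢B ∘ cong (profile c))
  ...   | _ , j , u∈cⱼ , v∈cⱼ = j , x∈p∩q⁺ (∈-profile⁺ u∈cⱼ , ∈-profile⁺ v∈cⱼ)

_⊆F_ : ∀ {m} → Family m → Family m → Set
F ⊆F G = ∀ J → J ∈F F → J ∈F G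

Compatible : ∀ {m} → Family m → Subset m → Set
Compatible {m} F J = All (λ A → A ∈F F → A ≢ J → Nonempty (A ∩ J)) (allSubsets m)

compatible? : ∀ {m} (F : Family m) (J : Subset m) → Dec (Compatible F J)
compatible? F J =
  All.all? (λ A → (F A Bool.≟ true) →-dec (¬? (A ≟ₛ J) →-dec nonempty? (A ∩ J))) _

insert : ∀ {m} → Family m → Subset m → Family m
insert F J A = F A ∨ A ≡ᵇ J

-- Scanning every subset once suffices: a subset rejected at some stage
-- stays rejected, since the family only grows.
greedy : ∀ {m} → Family m → List (Subset m) → Family m
greedy F [] = F
greedy F (J ∷ Js) with compatible? F J
... | yes _ = greedy (insert F J) Js
... | no _ = greedy F Js

⊆-greedy : ∀ {m} (F : Family m) Js → F ⊆F greedy F Js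
⊆-greedy F [] A A∈ = A∈
⊆-greedy F (J ∷ Js) A A∈ with compatible? F J
... | yes _ = ⊆-greedy (insert F J) Js A (cong (_∨ A ≡ᵇ J) A∈)
... | no _ = ⊆-greedy F Js A A∈

∈insert⁻ : ∀ {m} {F : Family m} {J A} → A ∈F insert F J → A ∈F F ⊎ A ≡ J
∈insert⁻ {F = F} {J} {A} A∈ with F A | A ≟ₛ J
... | true | _ = inj₁ refl
... | false | yes A≡J = inj₂ A≡J

insert-intersecting : ∀ {m} {F : Family m} {J} →
  Intersecting F → Compatible F J → Intersecting (insert F J)
insert-intersecting {m} {F} {J} F-int compat A B A∈ B∈ A≢B
  with ∈insert⁻ {F = F} {J} {A} A∈ | ∈insert⁻ {F = F} {J} {B} B∈
... | inj₁ A∈F | inj₁ B∈F = F-int A B A∈F B∈F A≢B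
... | inj₁ A∈F | inj₂ refl = All.lookup compat (∈-allSubsets m A) A∈F A≢B
... | inj₂ refl | inj₁ B∈F =
  subst Nonempty (∩-comm B A) (All.lookup compat (∈-allSubsets m B) B∈F (A≢B ∘ sym))
... | inj₂ refl | inj₂ refl = contradiction refl A≢B

greedy-intersecting : ∀ {m} {F : Family m} Js → Intersecting F → Intersecting (greedy F Js)
greedy-intersecting [] F-int = F-int
greedy-intersecting {F = F} (J ∷ Js) F-int with compatible? F J
... | yes compat = greedy-intersecting Js (insert-intersecting F-int compat)
... | no _ = greedy-intersecting Js F-int

greedy-saturated : ∀ {m} (F : Family m) Js (G : Family m) → Intersecting G → greedy F Js ⊆F G →
  ∀ J → J ∈ₗ Js → J ∈F G → J ∈F greedy F Js
greedy-saturated F (J ∷ Js) G G-int ⊆G .J (here refl) J∈G with compatible? F J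
... | yes _ = ⊆-greedy (insert F J) Js J (trans (cong (F J ∨_) (≡ᵇ-refl J)) (Bool.∨-zeroʳ (F J)))
... | no incompatible = contradiction
  (All.tabulate λ {A} _ A∈F A≢J → G-int A J (⊆G A (⊆-greedy F Js A A∈F)) J∈G A≢J) incompatible
greedy-saturated F (K ∷ Js) G G-int ⊆G J (there J∈Js) J∈G with compatible? F K
... | yes _ = greedy-saturated (insert F K) Js G G-int ⊆G J J∈Js J∈G
... | no _ = greedy-saturated F Js G G-int ⊆G J J∈Js J∈G

maximal-extension : ∀ {m} {F : Family m} → Intersecting F →
  Σ (Family m) λ G → MaximalIntersecting G × F ⊆F G
maximal-extension {m} {F} F-int =
  greedy F (allSubsets m) ,
  (greedy-intersecting (allSubsets m) F-int ,
   λ G G-int ⊆G J → greedy-saturated F (allSubsets m) G G-int ⊆G J (∈-allSubsets m J)) ,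
  ⊆-greedy F (allSubsets m)

bounded-maximum : ∀ {P : ℕ → Set} → Decidable P → P 0 → ∀ k → (∀ x → P x → x ≤ k) → ∃ (IsMaximum P)
bounded-maximum P? P0 zero ≤k = 0 , P0 , ≤k
bounded-maximum P? P0 (suc k) ≤k with P? (suc k)
... | yes Pk = suc k , Pk , ≤k
... | no ¬Pk = bounded-maximum P? P0 k λ x Px → s≤s⁻¹ (≤∧≢⇒< (≤k x Px) λ { refl → ¬Pk Px })

module _ {m n : ℕ} (c : Cliques m n) where

  CliqueSize : ℕ → Set
  CliqueSize x = Σ (Subset n) λ S → IsCliqueOfUnion c S × ∣ S ∣ ≡ x

  adj? : ∀ u v → Dec (Adj c u v)
  adj? u v = ¬? (u Fin.≟ v) ×-dec Fin.any? (λ j → (u ∈? c j) ×-dec (v ∈? c j))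

  isClique? : Decidable (IsCliqueOfUnion c)
  isClique? S = (S ⊆? V c) ×-dec map′ (λ h {u} {v} → h u v) (λ h u v → h {u} {v})
    (Fin.all? λ u → Fin.all? λ v → (u ∈? S) →-dec ((v ∈? S) →-dec (¬? (u Fin.≟ v) →-dec adj? u v)))

  cliqueNumber : ∃ (IsCliqueNumber c)
  cliqueNumber = bounded-maximum
    (λ x → anySubset? λ S → isClique? S ×-dec (∣ S ∣ ≟ x))
    (⊥ , ((λ v∈ → contradiction v∈ ∉⊥) , (λ v∈ → contradiction v∈ ∉⊥)) , ∣⊥∣≡0 n)
    n (λ x (S , _ , ∣S∣≡x) → subst (_≤ n) ∣S∣≡x (∣p∣≤n S))

  weight-isCliqueSize : ∀ {F} → Intersecting F → CliqueSize (sumOver F (γ c))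
  weight-isCliqueSize {F} F-int = ⋃Γ c F , ⋃Γ-isClique c F-int , sym (sumOver-γ≡∣⋃Γ∣ c F)

  clique≤weight : ∀ {S} → IsCliqueOfUnion c S →
    Σ (Family m) λ F → MaximalIntersecting F × ∣ S ∣ ≤ sumOver F (γ c)
  clique≤weight {S} S-clique with maximal-extension (profiles-intersecting c S-clique)
  ... | F , F-max , profiles⊆F = F , F-max ,
    subst (∣ S ∣ ≤_) (sym (sumOver-γ≡∣⋃Γ∣ c F)) (p⊆q⇒∣p∣≤∣q∣ S⊆⋃Γ)
    where
    S⊆⋃Γ : S ⊆ ⋃Γ c F
    S⊆⋃Γ v∈S = ∈⋃Γ⁺ c {F} (proj₁ S-clique v∈S) (profiles⊆F _ (profile∈profiles c v∈S))

corollary4p17 : ∀ (m n : ℕ) (c : Cliques m n) → ∃ λ ω → IsCliqueNumber c ω × IsMaxFamilyWeight c ω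
corollary4p17 m n c with cliqueNumber c
... | ω , ω-clique@(S , S-clique , ∣S∣≡ω) , ω-max with clique≤weight c S-clique
...   | F , F-max , ∣S∣≤weight =
  ω , (ω-clique , ω-max) , ((F , F-max , weight≡ω) , weight≤ω)
  where
  weight≤ω : ∀ x → (Σ (Family m) λ G → MaximalIntersecting G × sumOver G (γ c) ≡ x) → x ≤ ω
  weight≤ω x (G , G-max , refl) = ω-max x (weight-isCliqueSize c (proj₁ G-max))

  weight≡ω : sumOver F (γ c) ≡ ω
  weight≡ω = ≤-antisym (weight≤ω _ (F , F-max , refl)) (subst (_≤ sumOver F (γ c)) ∣S∣≡ω ∣S∣≤weight)
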